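{- Let $n\ge1$, $p$ a prime, and $R\subsetneq E_n$. Then the set $\{x\in\mathbb{Z}^n : F^{(i)}_R(x)\le0 \text{ for all } i\in E_n,\ x_j\ge0\text{ for all } j\in R\}$ equals the set of $x\in\mathbb{Z}^n$ that are linear combinations with nonnegative rational coefficients of the vectors $\lambda^{(i)}_k$, $1\le i\le h$, $1\le k\le g_i$.
   Context: $E_n=\{1,\dots,n\}$, indices mod $n$, $e_i$ the standard basis of $\mathbb{Z}^n$ (with $e_m$ for $m\in\mathbb{Z}$ defined $n$-periodically); $\delta_R^{(m)}=-1$ if $m\in R$, $1$ otherwise; $F^{(d)}_R(x)=\sum_{j=0}^{n-1}p^j\delta_R^{(d+j)}x_{d+j}$. Write $E_n\setminus R=\{r_1,\dots,r_h\}$ ($h=n-|R|\ge1$) so that $r_{i+1}$ is the first element of $E_n\setminus R$ in the sequence $r_i+1,r_i+2,\dots$ (mod $n$), with $r_{h+1}=r_1$, $r_0=r_h$. Let $g_i$ be the smallest positive integer with $r_{i-1}+g_i\equiv r_i\pmod n$. Define $\lambda^{(i)}_k=e_{r_i}+p^ke_{r_i-k}$ for $1\le k\le g_i-1$ and $\lambda^{(i)}_{g_i}=e_{r_i}-p^{g_i}e_{r_{i-1}}$. -}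

module Defs where

open import Data.Nat as ℕ using (ℕ; zero; suc; _∸_; NonZero)
open import Data.Nat.DivMod using (_mod_; _%_)
open import Data.Fin using (Fin; toℕ) renaming (zero to fzero; suc to fsuc)
open import Data.Fin.Properties using () renaming (_≟_ to _≟ᶠ_)
open import Data.Fin.Subset using (Subset; _∈_; _∉_)
open import Data.Vec using (lookup)
open import Data.Bool using (if_then_else_)
open import Data.Integer as ℤ using (ℤ; +_; -_)
open import Data.Rational as ℚ using (ℚ; 0ℚ)
open import Data.Product using (Σ; _×_)
open import Relation.Nullary using (yes; no; ¬_)
open import Relation.Binary.PropositionalEquality using (_≡_)

-- Indices: the element i of E_n = {1,…,n} is represented by the element
-- (i-1) of Fin n; arithmetic on indices is modulo n.

_⊕_ : ∀ {n} .{{_ : NonZero n}} → Fin n → ℕ → Fin n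
_⊕_ {n} d j = (toℕ d ℕ.+ j) mod n

-- d - k (mod n), valid for every k
_⊝_ : ∀ {n} .{{_ : NonZero n}} → Fin n → ℕ → Fin n
_⊝_ {n} d k = (toℕ d ℕ.+ (n ∸ (k % n))) mod n

Σℤ : ℕ → (ℕ → ℤ) → ℤ
Σℤ zero f = + 0
Σℤ (suc m) f = Σℤ m f ℤ.+ f m

Σℚ : ℕ → (ℕ → ℚ) → ℚ
Σℚ zero f = 0ℚ
Σℚ (suc m) f = Σℚ m f ℚ.+ f m

ΣFin : ∀ {n} → (Fin n → ℚ) → ℚ
ΣFin {zero} f = 0ℚ
ΣFin {suc n} f = f fzero ℚ.+ ΣFin (λ i → f (fsuc i))

δ : ∀ {n} → Subset n → Fin n → ℤ
δ R m = if lookup R m then - (+ 1) else + 1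

F : ∀ {n} .{{_ : NonZero n}} → ℕ → Subset n → Fin n → (Fin n → ℤ) → ℤ
F {n} p R d x = Σℤ n (λ j → (+ (p ℕ.^ j)) ℤ.* (δ R (d ⊕ j) ℤ.* x (d ⊕ j)))

InP : ∀ {n} .{{_ : NonZero n}} → ℕ → Subset n → (Fin n → ℤ) → Set
InP p R x = (∀ i → F p R i x ℤ.≤ + 0) × (∀ j → j ∈ R → + 0 ℤ.≤ x j)

-- g is the smallest positive integer with r - g ∉ R (mod n); for r = r_i ∉ R
-- this is exactly g_i (r - g_i ≡ r_{i-1}).
IsGap : ∀ {n} .{{_ : NonZero n}} → Subset n → Fin n → ℕ → Set
IsGap R r g = (1 ℕ.≤ g) × ((r ⊝ g) ∉ R) × (∀ g' → 1 ℕ.≤ g' → g' ℕ.< g → (r ⊝ g') ∈ R)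

eᵣ : ∀ {n} → Fin n → Fin n → ℤ
eᵣ r j with r ≟ᶠ j
... | yes _ = + 1
... | no _ = + 0

lam : ∀ {n} .{{_ : NonZero n}} → ℕ → (g : ℕ) → Fin n → ℕ → Fin n → ℤ
lam p g r k j with k ℕ.<? g
... | yes _ = eᵣ r j ℤ.+ (+ (p ℕ.^ k)) ℤ.* eᵣ (r ⊝ k) j
... | no _  = eᵣ r j ℤ.- (+ (p ℕ.^ g)) ℤ.* eᵣ (r ⊝ g) j

toℚ : ℤ → ℚ
toℚ z = z ℚ./ 1

comb : ∀ {n} .{{_ : NonZero n}} → ℕ → Subset n → (Fin n → ℕ) →
       (Fin n → ℕ → ℚ) → Fin n → ℚ
comb p R g c j =
  ΣFin (λ r → if lookup R r then 0ℚ
              else Σℚ (g r) (λ k′ → c r (suc k′) ℚ.* toℚ (lam p (g r) r (suc k′) j)))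

InCone : ∀ {n} .{{_ : NonZero n}} → ℕ → Subset n → (Fin n → ℕ) → (Fin n → ℤ) → Set
InCone {n} p R g x = Σ (Fin n → ℕ → ℚ) λ c → (∀ r k → 0ℚ ℚ.≤ c r k) × (∀ j → toℚ (x j) ≡ comb p R g c j)

-- Everything is compared over ℚ. Each F^(d) is linear, so the cone lies in the polyhedron once
-- every generator does: F^(d)(λ^(r)_k) = p^t − p^(k+t′), where t and t′ are the offsets of r and
-- r − k from d, so that t ≤ k + t′; and λ^(r)_k is nonnegative on R.
-- Conversely, put y_d = −F^(d)(x)/(p^n − 1) ≥ 0. Rotating the sum that defines F^(d) gives
-- F^(d) = p F^(d+1) + (1 − p^n) δ_d x_d, i.e. y_d = p y_(d+1) + δ_d x_d. Take c_(r,k) = x_(r−k)/p^k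
-- for k < g_r (nonnegative because r − k ∈ R) and c_(r,g_r) = y_(r−g_r+1)/p^(g_r−1). Coordinate j
-- of Σ c λ is Σ_k c_(j,k) when j ∉ R, which telescopes to y_j, plus the single term of the λ^(r)_k
-- with r − k = j, r being the first element of E_n ∖ R after j; that term is x_j if j ∈ R and
-- −p y_(j+1) if j ∉ R, so the coordinate is x_j in both cases.

{-# OPTIONS --safe #-}
module Submission where

open import Defs
open import Algebra.Bundles using (CommutativeRing)
open import Data.Bool using (true; false; if_then_else_)
open import Data.Bool.Properties using (¬-not)
open import Data.List using (_∷_; [])
open import Data.Nat as ℕ using (ℕ; zero; suc; _∸_; _%_; _<_; NonZero; z≤n; s≤s; nonTrivial⇒n>1)
import Data.Nat.Properties as ℕ
open import Data.Nat.DivMod using (%-distribˡ-+; m%n%n≡m%n; [m+n]%n≡m%n; m<n⇒m%n≡m; m%n≤n; m%n≤m)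
open import Data.Nat.Primality using (Prime; prime⇒nonTrivial)
open import Data.Fin as Fin using (Fin; toℕ; fromℕ<)
open import Data.Fin.Properties using (toℕ-fromℕ<; toℕ-injective; toℕ<n; toℕ-inject; suc-injective; ¬∀⟶∃¬-smallest)
  renaming (_≟_ to _≟ᶠ_)
open import Data.Fin.Subset using (Subset; _∈_; _∉_)
open import Data.Fin.Subset.Properties using (_∈?_)
open import Data.Integer as ℤ using (ℤ; +_)
import Data.Integer.Properties as ℤ
open import Data.Integer.Tactic.RingSolver as ℤ-Solver using ()
open import Data.Product using (Σ; ∃; _×_; _,_; proj₁; proj₂)
open import Data.Sum using (inj₁; inj₂)
open import Data.Rational as ℚ using (ℚ; 0ℚ; 1ℚ; _+_; _*_; -_; _-_; _≤_; fromℚᵘ)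
open import Data.Rational.Properties
import Data.Rational.Unnormalised as ℚᵘ
import Data.Rational.Unnormalised.Properties as ℚᵘ
open import Algebra.Properties.CommutativeSemiring.Exp (CommutativeRing.commutativeSemiring +-*-commutativeRing)
  using (_^_; ^-homo-*)
open import Algebra.Properties.CommutativeMonoid.Sum +-0-commutativeMonoid
  using (sum; sum-cong-≗; ∑-distrib-+; sum-replicate-zero)
open import Data.Vec using (lookup)
open import Data.Vec.Properties using ([]=⇒lookup; lookup⇒[]=)
open import Function using (_∘_)
open import Function.Bundles using (_⇔_; mk⇔)
open import Relation.Binary.Definitions using (tri<; tri≈; tri>)
open import Relation.Binary.PropositionalEquality
open import Relation.Nullary using (¬_; yes; no; contradiction)
open import Relation.Nullary.Decidable using (dec⇒maybe)
open import Tactic.RingSolver using (solve-∀)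
open import Tactic.RingSolver.Core.AlmostCommutativeRing using (AlmostCommutativeRing; fromCommutativeRing)

[m%d+n]%d≡[m+n]%d : ∀ m n d .{{_ : NonZero d}} → (m % d ℕ.+ n) % d ≡ (m ℕ.+ n) % d
[m%d+n]%d≡[m+n]%d m n d = begin
  (m % d ℕ.+ n) % d         ≡⟨ %-distribˡ-+ (m % d) n d ⟩
  (m % d % d ℕ.+ n % d) % d ≡⟨ cong (λ z → (z ℕ.+ n % d) % d) (m%n%n≡m%n m d) ⟩
  (m % d ℕ.+ n % d) % d     ≡⟨ %-distribˡ-+ m n d ⟨
  (m ℕ.+ n) % d             ∎
  where open ≡-Reasoning

[m+n%d]%d≡[m+n]%d : ∀ m n d .{{_ : NonZero d}} → (m ℕ.+ n % d) % d ≡ (m ℕ.+ n) % d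
[m+n%d]%d≡[m+n]%d m n d = begin
  (m ℕ.+ n % d) % d ≡⟨ cong (_% d) (ℕ.+-comm m (n % d)) ⟩
  (n % d ℕ.+ m) % d ≡⟨ [m%d+n]%d≡[m+n]%d n m d ⟩
  (n ℕ.+ m) % d     ≡⟨ cong (_% d) (ℕ.+-comm n m) ⟩
  (m ℕ.+ n) % d     ∎
  where open ≡-Reasoning

∉⇒lookup≡false : ∀ {n} {R : Subset n} {r} → r ∉ R → lookup R r ≡ false
∉⇒lookup≡false {R = R} {r} r∉R = ¬-not (r∉R ∘ lookup⇒[]= r R)

lookup≡false⇒∉ : ∀ {n} {R : Subset n} {r} → lookup R r ≡ false → r ∉ R
lookup≡false⇒∉ r∉R r∈R with trans (sym ([]=⇒lookup r∈R)) r∉R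
... | ()

module _ {n : ℕ} .{{_ : NonZero n}} where

  toℕ-⊕ : ∀ (d : Fin n) k → toℕ (d ⊕ k) ≡ (toℕ d ℕ.+ k) % n
  toℕ-⊕ d k = toℕ-fromℕ< _

  ⊕-+ : ∀ (d : Fin n) a b → (d ⊕ a) ⊕ b ≡ d ⊕ (a ℕ.+ b)
  ⊕-+ d a b = toℕ-injective (begin
    toℕ ((d ⊕ a) ⊕ b)               ≡⟨ toℕ-⊕ (d ⊕ a) b ⟩
    (toℕ (d ⊕ a) ℕ.+ b) % n         ≡⟨ cong (λ z → (z ℕ.+ b) % n) (toℕ-⊕ d a) ⟩
    ((toℕ d ℕ.+ a) % n ℕ.+ b) % n   ≡⟨ [m%d+n]%d≡[m+n]%d (toℕ d ℕ.+ a) b n ⟩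
    (toℕ d ℕ.+ a ℕ.+ b) % n         ≡⟨ cong (_% n) (ℕ.+-assoc (toℕ d) a b) ⟩
    (toℕ d ℕ.+ (a ℕ.+ b)) % n       ≡⟨ toℕ-⊕ d (a ℕ.+ b) ⟨
    toℕ (d ⊕ (a ℕ.+ b))             ∎)
    where open ≡-Reasoning

  ⊕-% : ∀ (d : Fin n) k → d ⊕ (k % n) ≡ d ⊕ k
  ⊕-% d k = toℕ-injective (trans (toℕ-⊕ d (k % n))
    (trans ([m+n%d]%d≡[m+n]%d (toℕ d) k n) (sym (toℕ-⊕ d k))))

  ⊕-identityʳ : ∀ (d : Fin n) → d ⊕ 0 ≡ d
  ⊕-identityʳ d = toℕ-injective (trans (toℕ-⊕ d 0)
    (trans (cong (_% n) (ℕ.+-identityʳ (toℕ d))) (m<n⇒m%n≡m (toℕ<n d))))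

  ⊕-n : ∀ (d : Fin n) → d ⊕ n ≡ d
  ⊕-n d = toℕ-injective (trans (toℕ-⊕ d n)
    (trans ([m+n]%n≡m%n (toℕ d) n) (m<n⇒m%n≡m (toℕ<n d))))

  ⊝-⊕ : ∀ (d : Fin n) k → (d ⊝ k) ⊕ k ≡ d
  ⊝-⊕ d k = begin
    (d ⊕ (n ∸ k % n)) ⊕ k         ≡⟨ ⊕-% _ k ⟨
    (d ⊕ (n ∸ k % n)) ⊕ (k % n)   ≡⟨ ⊕-+ d _ (k % n) ⟩
    d ⊕ ((n ∸ k % n) ℕ.+ k % n)   ≡⟨ cong (d ⊕_) (ℕ.m∸n+n≡m (m%n≤n k n)) ⟩
    d ⊕ n                         ≡⟨ ⊕-n d ⟩
    d                             ∎
    where open ≡-Reasoning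

  ⊕-⊝ : ∀ (d : Fin n) k → (d ⊕ k) ⊝ k ≡ d
  ⊕-⊝ d k = begin
    (d ⊕ k) ⊕ (n ∸ k % n)         ≡⟨ cong (_⊕ (n ∸ k % n)) (⊕-% d k) ⟨
    (d ⊕ (k % n)) ⊕ (n ∸ k % n)   ≡⟨ ⊕-+ d (k % n) _ ⟩
    d ⊕ (k % n ℕ.+ (n ∸ k % n))   ≡⟨ cong (d ⊕_) (ℕ.m+[n∸m]≡n (m%n≤n k n)) ⟩
    d ⊕ n                         ≡⟨ ⊕-n d ⟩
    d                             ∎
    where open ≡-Reasoning

  ⊕⇒⊝ : ∀ {e d : Fin n} {k} → e ⊕ k ≡ d → e ≡ d ⊝ k
  ⊕⇒⊝ {e} {k = k} eq = trans (sym (⊕-⊝ e k)) (cong (_⊝ k) eq)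

  ⊝⇒⊕ : ∀ {d e : Fin n} {k} → d ⊝ k ≡ e → d ≡ e ⊕ k
  ⊝⇒⊕ {d} {k = k} eq = trans (sym (⊝-⊕ d k)) (cong (_⊕ k) eq)

  ⊕-comm : ∀ (d e : Fin n) → d ⊕ toℕ e ≡ e ⊕ toℕ d
  ⊕-comm d e = toℕ-injective (trans (toℕ-⊕ d (toℕ e))
    (trans (cong (_% n) (ℕ.+-comm (toℕ d) (toℕ e))) (sym (toℕ-⊕ e (toℕ d)))))

  offset : Fin n → Fin n → ℕ
  offset d r = toℕ (r ⊝ toℕ d)

  ⊕-offset : ∀ (d r : Fin n) → d ⊕ offset d r ≡ r
  ⊕-offset d r = trans (⊕-comm d (r ⊝ toℕ d)) (⊝-⊕ r (toℕ d))

  offset<n : ∀ (d r : Fin n) → offset d r < n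
  offset<n d r = toℕ<n (r ⊝ toℕ d)

  %-via-⊕ : ∀ (d : Fin n) k → k % n ≡ (toℕ (d ⊕ k) ℕ.+ (n ∸ toℕ d)) % n
  %-via-⊕ d k = begin
    k % n                                     ≡⟨ [m+n]%n≡m%n k n ⟨
    (k ℕ.+ n) % n                             ≡⟨ cong (_% n) (cancel (toℕ d) k (ℕ.<⇒≤ (toℕ<n d))) ⟨
    (toℕ d ℕ.+ k ℕ.+ (n ∸ toℕ d)) % n         ≡⟨ [m%d+n]%d≡[m+n]%d (toℕ d ℕ.+ k) _ n ⟨
    ((toℕ d ℕ.+ k) % n ℕ.+ (n ∸ toℕ d)) % n   ≡⟨ cong (λ z → (z ℕ.+ (n ∸ toℕ d)) % n) (toℕ-⊕ d k) ⟨
    (toℕ (d ⊕ k) ℕ.+ (n ∸ toℕ d)) % n         ∎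
    where
    open ≡-Reasoning
    cancel : ∀ a b → a ℕ.≤ n → a ℕ.+ b ℕ.+ (n ∸ a) ≡ b ℕ.+ n
    cancel a b a≤n = begin
      a ℕ.+ b ℕ.+ (n ∸ a)     ≡⟨ cong (ℕ._+ (n ∸ a)) (ℕ.+-comm a b) ⟩
      b ℕ.+ a ℕ.+ (n ∸ a)     ≡⟨ ℕ.+-assoc b a (n ∸ a) ⟩
      b ℕ.+ (a ℕ.+ (n ∸ a))   ≡⟨ cong (b ℕ.+_) (ℕ.m+[n∸m]≡n a≤n) ⟩
      b ℕ.+ n                 ∎

  ⊕-injective : ∀ (d : Fin n) {a b} → d ⊕ a ≡ d ⊕ b → a % n ≡ b % n
  ⊕-injective d {a} {b} eq = trans (%-via-⊕ d a)
    (trans (cong (λ e → (toℕ e ℕ.+ (n ∸ toℕ d)) % n) eq) (sym (%-via-⊕ d b)))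

  offset-⊝ : ∀ (d r : Fin n) k → offset d r ℕ.≤ k ℕ.+ offset d (r ⊝ k)
  offset-⊝ d r k = subst₂ ℕ._≤_ [t′+k]%n≡t (ℕ.+-comm t′ k) (m%n≤m (t′ ℕ.+ k) n)
    where
    open ≡-Reasoning
    t′ = offset d (r ⊝ k)
    [t′+k]%n≡t : (t′ ℕ.+ k) % n ≡ offset d r
    [t′+k]%n≡t = trans (⊕-injective d (begin
      d ⊕ (t′ ℕ.+ k)   ≡⟨ ⊕-+ d t′ k ⟨
      (d ⊕ t′) ⊕ k     ≡⟨ cong (_⊕ k) (⊕-offset d (r ⊝ k)) ⟩
      (r ⊝ k) ⊕ k      ≡⟨ ⊝-⊕ r k ⟩
      r                ≡⟨ ⊕-offset d r ⟨
      d ⊕ offset d r   ∎)) (m<n⇒m%n≡m (offset<n d r))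

  ⊝-identityʳ : ∀ (d : Fin n) → d ⊝ 0 ≡ d
  ⊝-identityʳ d = trans (sym (⊕-identityʳ (d ⊝ 0))) (⊝-⊕ d 0)

  ⊝-suc-⊕ : ∀ (d : Fin n) k → (d ⊝ suc k) ⊕ 1 ≡ d ⊝ k
  ⊝-suc-⊕ d k = ⊕⇒⊝ (trans (⊕-+ (d ⊝ suc k) 1 k) (⊝-⊕ d (suc k)))

  ⊕-as-⊝ : ∀ (j : Fin n) {i k} → i ℕ.≤ k → j ⊕ i ≡ (j ⊕ k) ⊝ (k ∸ i)
  ⊕-as-⊝ j {i} {k} i≤k = ⊕⇒⊝ (trans (⊕-+ j i (k ∸ i)) (cong (j ⊕_) (ℕ.m+[n∸m]≡n i≤k)))

  record NextOutside (R : Subset n) (j : Fin n) : Set where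
    field
      t       : ℕ
      outside : j ⊕ suc t ∉ R
      between : ∀ m → m < t → j ⊕ suc m ∈ R

  nextOutside : ∀ (R : Subset n) {r₀} → r₀ ∉ R → ∀ j → NextOutside R j
  nextOutside R {r₀} r₀∉R j with ¬∀⟶∃¬-smallest n (λ i → j ⊕ suc (toℕ i) ∈ R) (λ i → _ ∈? R) notAll
    where
    notAll : ¬ (∀ i → j ⊕ suc (toℕ i) ∈ R)
    notAll all = r₀∉R (subst (_∈ R) hits (all (r₀ ⊝ toℕ (j ⊕ 1))))
      where
      hits : j ⊕ suc (offset (j ⊕ 1) r₀) ≡ r₀
      hits = trans (sym (⊕-+ j 1 _)) (⊕-offset (j ⊕ 1) r₀)
  ... | i , i∉R , smaller = record
    { t = toℕ i
    ; outside = i∉R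
    ; between = λ m m<t → subst (λ z → j ⊕ suc z ∈ R)
        (trans (toℕ-inject (fromℕ< m<t)) (toℕ-fromℕ< m<t)) (smaller (fromℕ< m<t))
    }

  module _ {R : Subset n} {g : Fin n → ℕ} (gap : ∀ r → r ∉ R → IsGap R r (g r)) where

    gap-positive : ∀ {r} → r ∉ R → 1 ℕ.≤ g r
    gap-positive r∉R = proj₁ (gap _ r∉R)

    gap-outside : ∀ {r} → r ∉ R → r ⊝ g r ∉ R
    gap-outside r∉R = proj₁ (proj₂ (gap _ r∉R))

    gap-inside : ∀ {r k} → r ∉ R → 1 ℕ.≤ k → k < g r → r ⊝ k ∈ R
    gap-inside r∉R = proj₂ (proj₂ (gap _ r∉R)) _

    module Next {j : Fin n} (N : NextOutside R j) where

      open NextOutside N public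

      next : Fin n
      next = j ⊕ suc t

      next-⊝ : next ⊝ suc t ≡ j
      next-⊝ = ⊕-⊝ j (suc t)

      ⊝≡j⇒≡t : ∀ {r m} → r ∉ R → suc m ℕ.≤ g r → r ⊝ suc m ≡ j → m ≡ t
      ⊝≡j⇒≡t {r} {m} r∉R m<g r⊝m≡j with ℕ.<-cmp m t
      ... | tri≈ _ m≡t _ = m≡t
      ... | tri< m<t _ _ = contradiction (subst (_∈ R) (sym (⊝⇒⊕ r⊝m≡j)) (between m m<t)) r∉R
      ... | tri> _ _ t<m = contradiction (subst (_∈ R) (sym next≡) (gap-inside r∉R (ℕ.m<n⇒0<n∸m t<m) m∸t<g))
                                         outside
        where
        next≡ : next ≡ r ⊝ (m ∸ t)
        next≡ = trans (⊕-as-⊝ j (s≤s (ℕ.<⇒≤ t<m))) (cong (_⊝ (m ∸ t)) (sym (⊝⇒⊕ r⊝m≡j)))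
        m∸t<g : m ∸ t < g r
        m∸t<g = ℕ.<-≤-trans (s≤s (ℕ.m∸n≤m m t)) m<g

      t<g-next : t < g next
      t<g-next with ℕ.≤-<-connex (g next) t
      ... | inj₂ t<g = t<g
      ... | inj₁ g≤t = contradiction (subst (_∈ R) ⊕≡⊝ (between (t ∸ g next) t∸g<t)) (gap-outside outside)
        where
        t∸g<t : t ∸ g next < t
        t∸g<t = ℕ.∸-monoʳ-< (gap-positive outside) g≤t
        ⊕≡⊝ : j ⊕ suc (t ∸ g next) ≡ next ⊝ g next
        ⊕≡⊝ = trans (cong (j ⊕_) (sym (ℕ.+-∸-assoc 1 g≤t)))
          (trans (⊕-as-⊝ j (ℕ.m∸n≤m (suc t) (g next)))
                 (cong (next ⊝_) (ℕ.m∸[m∸n]≡n (ℕ.m≤n⇒m≤1+n g≤t))))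

      g-next-∉ : j ∉ R → g next ≡ suc t
      g-next-∉ j∉R with ℕ.m≤n⇒m<n∨m≡n t<g-next
      ... | inj₂ 1+t≡g = sym 1+t≡g
      ... | inj₁ 1+t<g = contradiction (subst (_∈ R) next-⊝ (gap-inside outside (s≤s z≤n) 1+t<g)) j∉R

      t<g-next-∈ : j ∈ R → suc t < g next
      t<g-next-∈ j∈R with ℕ.m≤n⇒m<n∨m≡n t<g-next
      ... | inj₁ 1+t<g = 1+t<g
      ... | inj₂ 1+t≡g = contradiction (subst (_∈ R) (trans (sym next-⊝) (cong (next ⊝_) 1+t≡g)) j∈R)
                                       (gap-outside outside)

ℚ-ring : AlmostCommutativeRing _ _
ℚ-ring = fromCommutativeRing +-*-commutativeRing (λ x → dec⇒maybe (0ℚ ≟ x))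

fromℚᵘ-homo-+ : ∀ a b → fromℚᵘ (a ℚᵘ.+ b) ≡ fromℚᵘ a + fromℚᵘ b
fromℚᵘ-homo-+ a b = toℚᵘ-injective (ℚᵘ.≃-trans (toℚᵘ-fromℚᵘ _) (ℚᵘ.≃-trans
  (ℚᵘ.+-cong (ℚᵘ.≃-sym (toℚᵘ-fromℚᵘ a)) (ℚᵘ.≃-sym (toℚᵘ-fromℚᵘ b)))
  (ℚᵘ.≃-sym (toℚᵘ-homo-+ (fromℚᵘ a) (fromℚᵘ b)))))

fromℚᵘ-homo-* : ∀ a b → fromℚᵘ (a ℚᵘ.* b) ≡ fromℚᵘ a * fromℚᵘ b
fromℚᵘ-homo-* a b = toℚᵘ-injective (ℚᵘ.≃-trans (toℚᵘ-fromℚᵘ _) (ℚᵘ.≃-trans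
  (ℚᵘ.*-cong (ℚᵘ.≃-sym (toℚᵘ-fromℚᵘ a)) (ℚᵘ.≃-sym (toℚᵘ-fromℚᵘ b)))
  (ℚᵘ.≃-sym (toℚᵘ-homo-* (fromℚᵘ a) (fromℚᵘ b)))))

fromℚᵘ-homo‿- : ∀ a → fromℚᵘ (ℚᵘ.- a) ≡ - fromℚᵘ a
fromℚᵘ-homo‿- a = toℚᵘ-injective (ℚᵘ.≃-trans (toℚᵘ-fromℚᵘ _) (ℚᵘ.≃-trans
  (ℚᵘ.-‿cong (ℚᵘ.≃-sym (toℚᵘ-fromℚᵘ a))) (ℚᵘ.≃-sym (toℚᵘ-homo‿- (fromℚᵘ a)))))

-- toℚ z is definitionally fromℚᵘ (mkℚᵘ z 0), so the homomorphism properties of fromℚᵘ transfer.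
toℚ-homo-+ : ∀ a b → toℚ (a ℤ.+ b) ≡ toℚ a + toℚ b
toℚ-homo-+ a b = trans (fromℚᵘ-cong embed-+) (fromℚᵘ-homo-+ (ℚᵘ.mkℚᵘ a 0) (ℚᵘ.mkℚᵘ b 0))
  where
  embed-+ : ℚᵘ.mkℚᵘ (a ℤ.+ b) 0 ℚᵘ.≃ ℚᵘ.mkℚᵘ a 0 ℚᵘ.+ ℚᵘ.mkℚᵘ b 0
  embed-+ = ℚᵘ.*≡* cross
    where
    cross : (a ℤ.+ b) ℤ.* + 1 ≡ (a ℤ.* + 1 ℤ.+ b ℤ.* + 1) ℤ.* + 1
    cross = ℤ-Solver.solve (a ∷ b ∷ [])

toℚ-homo-* : ∀ a b → toℚ (a ℤ.* b) ≡ toℚ a * toℚ b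
toℚ-homo-* a b = fromℚᵘ-homo-* (ℚᵘ.mkℚᵘ a 0) (ℚᵘ.mkℚᵘ b 0)

toℚ-homo‿- : ∀ a → toℚ (ℤ.- a) ≡ - toℚ a
toℚ-homo‿- a = fromℚᵘ-homo‿- (ℚᵘ.mkℚᵘ a 0)

toℚ-homo-sub : ∀ a b → toℚ (a ℤ.- b) ≡ toℚ a + - toℚ b
toℚ-homo-sub a b = trans (toℚ-homo-+ a (ℤ.- b)) (cong (_+_ (toℚ a)) (toℚ-homo‿- b))

toℚ-mono-≤ : ∀ {a b} → a ℤ.≤ b → toℚ a ≤ toℚ b
toℚ-mono-≤ {a} {b} a≤b = toℚᵘ-cancel-≤
  (ℚᵘ.≤-respʳ-≃ (ℚᵘ.≃-sym (toℚᵘ-fromℚᵘ (ℚᵘ.mkℚᵘ b 0)))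
  (ℚᵘ.≤-respˡ-≃ (ℚᵘ.≃-sym (toℚᵘ-fromℚᵘ (ℚᵘ.mkℚᵘ a 0)))
  (ℚᵘ.*≤* (ℤ.*-monoʳ-≤-nonNeg (+ 1) a≤b))))

toℚ-cancel-≤ : ∀ {a b} → toℚ a ≤ toℚ b → a ℤ.≤ b
toℚ-cancel-≤ {a} {b} a≤b with ℚᵘ.≤-respʳ-≃ (toℚᵘ-fromℚᵘ (ℚᵘ.mkℚᵘ b 0))
  (ℚᵘ.≤-respˡ-≃ (toℚᵘ-fromℚᵘ (ℚᵘ.mkℚᵘ a 0)) (toℚᵘ-mono-≤ a≤b))
... | ℚᵘ.*≤* a*1≤b*1 = ℤ.*-cancelʳ-≤-pos a b (+ 1) a*1≤b*1

toℚ-^ : ∀ m k → toℚ (+ (m ℕ.^ k)) ≡ toℚ (+ m) ^ k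
toℚ-^ m zero = refl
toℚ-^ m (suc k) = trans (cong toℚ (ℤ.pos-* m (m ℕ.^ k)))
  (trans (toℚ-homo-* (+ m) (+ (m ℕ.^ k))) (cong (toℚ (+ m) *_) (toℚ-^ m k)))

_⁻¹ : (m : ℕ) .{{_ : NonZero m}} → ℚ
m ⁻¹ = + 1 ℚ./ m

toℚ-*-⁻¹ : ∀ m .{{_ : NonZero m}} → toℚ (+ m) * m ⁻¹ ≡ 1ℚ
toℚ-*-⁻¹ (suc m) = trans (sym (fromℚᵘ-homo-* (ℚᵘ.mkℚᵘ (+ suc m) 0) (ℚᵘ.mkℚᵘ (+ 1) m)))
  (fromℚᵘ-cong (ℚᵘ.*-inverseʳ (ℚᵘ.mkℚᵘ (+ suc m) 0)))

⁻¹-nonNeg : ∀ m .{{_ : NonZero m}} → 0ℚ ≤ m ⁻¹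
⁻¹-nonNeg m = nonNegative⁻¹ _ {{normalize-nonNeg 1 m}}

0≤toℚ+ : ∀ m → 0ℚ ≤ toℚ (+ m)
0≤toℚ+ m = toℚ-mono-≤ {+ 0} {+ m} (ℤ.+≤+ z≤n)

*-nonNeg : ∀ {x y} → 0ℚ ≤ x → 0ℚ ≤ y → 0ℚ ≤ x * y
*-nonNeg {x} {y} 0≤x 0≤y = nonNegative⁻¹ _
  {{nonNeg*nonNeg⇒nonNeg x {{ℚ.nonNegative 0≤x}} y {{ℚ.nonNegative 0≤y}}}}

^-nonNeg : ∀ {x} k → 0ℚ ≤ x → 0ℚ ≤ x ^ k
^-nonNeg zero 0≤x = ℚ.*≤* (ℤ.+≤+ ℕ.z≤n)
^-nonNeg (suc k) 0≤x = *-nonNeg 0≤x (^-nonNeg k 0≤x)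

^-inverse : ∀ {x y} k → x * y ≡ 1ℚ → x ^ k * y ^ k ≡ 1ℚ
^-inverse zero xy≡1 = refl
^-inverse {x} {y} (suc k) xy≡1 = begin
  x * x ^ k * (y * y ^ k)    ≡⟨ interchange x (x ^ k) y (y ^ k) ⟩
  (x * y) * (x ^ k * y ^ k)  ≡⟨ cong₂ _*_ xy≡1 (^-inverse k xy≡1) ⟩
  1ℚ * 1ℚ                    ≡⟨⟩
  1ℚ                         ∎
  where
  open ≡-Reasoning
  interchange : ∀ a b c d → a * b * (c * d) ≡ a * c * (b * d)
  interchange = solve-∀ ℚ-ring

p≤q⇒p-q≤0 : ∀ {x y} → x ≤ y → x - y ≤ 0ℚ
p≤q⇒p-q≤0 {x} {y} x≤y = subst (x - y ≤_) (+-inverseʳ y) (+-monoˡ-≤ (- y) x≤y)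

Σℚ-cong : ∀ m {f h : ℕ → ℚ} → (∀ k → k < m → f k ≡ h k) → Σℚ m f ≡ Σℚ m h
Σℚ-cong zero f≡h = refl
Σℚ-cong (suc m) f≡h = cong₂ _+_ (Σℚ-cong m (λ k k<m → f≡h k (ℕ.m<n⇒m<1+n k<m))) (f≡h m ℕ.≤-refl)

Σℚ-+ : ∀ m (f h : ℕ → ℚ) → Σℚ m (λ k → f k + h k) ≡ Σℚ m f + Σℚ m h
Σℚ-+ zero f h = refl
Σℚ-+ (suc m) f h = trans (cong (_+ (f m + h m)) (Σℚ-+ m f h)) (interchange (Σℚ m f) (Σℚ m h) (f m) (h m))
  where
  interchange : ∀ a b c d → (a + b) + (c + d) ≡ (a + c) + (b + d)
  interchange = solve-∀ ℚ-ring

Σℚ-*ˡ : ∀ m c (f : ℕ → ℚ) → Σℚ m (λ k → c * f k) ≡ c * Σℚ m f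
Σℚ-*ˡ zero c f = sym (*-zeroʳ c)
Σℚ-*ˡ (suc m) c f = trans (cong (_+ c * f m) (Σℚ-*ˡ m c f)) (sym (*-distribˡ-+ c (Σℚ m f) (f m)))

Σℚ-zero : ∀ m {f : ℕ → ℚ} → (∀ k → k < m → f k ≡ 0ℚ) → Σℚ m f ≡ 0ℚ
Σℚ-zero zero f≡0 = refl
Σℚ-zero (suc m) f≡0 = cong₂ _+_ (Σℚ-zero m (λ k k<m → f≡0 k (ℕ.m<n⇒m<1+n k<m))) (f≡0 m ℕ.≤-refl)

Σℚ-δ : ∀ m {f : ℕ → ℚ} {t} → t < m → (∀ k → k < m → k ≢ t → f k ≡ 0ℚ) → Σℚ m f ≡ f t
Σℚ-δ (suc m) {f} {t} t<1+m f≡0 with t ℕ.≟ m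
... | yes refl = trans (cong (_+ f t) (Σℚ-zero m (λ k k<t → f≡0 k (ℕ.m<n⇒m<1+n k<t) (ℕ.<⇒≢ k<t))))
                       (+-identityˡ (f t))
... | no t≢m = trans (cong₂ _+_ (Σℚ-δ m t<m (λ k k<m → f≡0 k (ℕ.m<n⇒m<1+n k<m))) (f≡0 m ℕ.≤-refl (t≢m ∘ sym)))
                     (+-identityʳ (f t))
  where
  t<m : t < m
  t<m = ℕ.≤∧≢⇒< (ℕ.≤-pred t<1+m) t≢m

Σℚ-head : ∀ m (f : ℕ → ℚ) → Σℚ (suc m) f ≡ f 0 + Σℚ m (f ∘ suc)
Σℚ-head zero f = trans (+-identityˡ (f 0)) (sym (+-identityʳ (f 0)))
Σℚ-head (suc m) f = trans (cong (_+ f (suc m)) (Σℚ-head m f)) (+-assoc (f 0) _ _)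

Σℚ-telescope : ∀ m (a : ℕ → ℚ) → Σℚ m (λ k → a k - a (suc k)) ≡ a 0 - a m
Σℚ-telescope zero a = sym (+-inverseʳ (a 0))
Σℚ-telescope (suc m) a =
  trans (cong (_+ (a m - a (suc m))) (Σℚ-telescope m a)) (cancel (a 0) (a m) (a (suc m)))
  where
  cancel : ∀ x y z → (x - y) + (y - z) ≡ x - z
  cancel = solve-∀ ℚ-ring

toℚ-Σℤ : ∀ m (f : ℕ → ℤ) → toℚ (Σℤ m f) ≡ Σℚ m (toℚ ∘ f)
toℚ-Σℤ zero f = refl
toℚ-Σℤ (suc m) f = trans (toℚ-homo-+ (Σℤ m f) (f m)) (cong (_+ toℚ (f m)) (toℚ-Σℤ m f))

ΣFin≡sum : ∀ {m} (f : Fin m → ℚ) → ΣFin f ≡ sum f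
ΣFin≡sum {zero} f = refl
ΣFin≡sum {suc m} f = cong (_+_ (f Fin.zero)) (ΣFin≡sum (f ∘ Fin.suc))

sum-δ : ∀ {m} (f : Fin m → ℚ) i → (∀ r → r ≢ i → f r ≡ 0ℚ) → sum f ≡ f i
sum-δ {suc m} f Fin.zero f≡0 = trans
  (cong (_+_ (f Fin.zero)) (trans (sum-cong-≗ (λ r → f≡0 (Fin.suc r) λ ())) (sum-replicate-zero m)))
  (+-identityʳ _)
sum-δ {suc m} f (Fin.suc i) f≡0 = trans
  (cong₂ _+_ (f≡0 Fin.zero λ ()) (sum-δ (f ∘ Fin.suc) i (λ r r≢i → f≡0 (Fin.suc r) (r≢i ∘ suc-injective))))
  (+-identityˡ _)

eᵣ-same : ∀ {n} (r : Fin n) → eᵣ r r ≡ + 1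
eᵣ-same r with r ≟ᶠ r
... | yes _ = refl
... | no r≢r = contradiction refl r≢r

eᵣ-diff : ∀ {n} {r j : Fin n} → r ≢ j → eᵣ r j ≡ + 0
eᵣ-diff {r = r} {j} r≢j with r ≟ᶠ j
... | yes r≡j = contradiction r≡j r≢j
... | no _ = refl

eᵣ-nonNeg : ∀ {n} (r j : Fin n) → 0ℚ ≤ toℚ (eᵣ r j)
eᵣ-nonNeg r j with r ≟ᶠ j
... | yes _ = 0≤toℚ+ 1
... | no _ = 0≤toℚ+ 0

sum-eᵣ : ∀ {n} (i : Fin n) (f : Fin n → ℚ) → sum (λ r → toℚ (eᵣ r i) * f r) ≡ f i
sum-eᵣ i f = trans (sum-δ _ i (λ r r≢i → trans (cong (λ z → toℚ z * f r) (eᵣ-diff r≢i)) (*-zeroˡ (f r))))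
                   (trans (cong (λ z → toℚ z * f i) (eᵣ-same i)) (*-identityˡ (f i)))

record IsConvexCone {n} (C : (Fin n → ℚ) → Set) : Set where
  field
    zero∈ : C (λ _ → 0ℚ)
    +-closed : ∀ {u v} → C u → C v → C (λ i → u i + v i)
    *-closed : ∀ {c v} → 0ℚ ≤ c → C v → C (λ i → c * v i)

  Σℚ-closed : ∀ m {f : ℕ → Fin n → ℚ} → (∀ k → k < m → C (f k)) → C (λ i → Σℚ m (λ k → f k i))
  Σℚ-closed zero f∈ = zero∈
  Σℚ-closed (suc m) f∈ = +-closed (Σℚ-closed m (λ k k<m → f∈ k (ℕ.m<n⇒m<1+n k<m))) (f∈ m ℕ.≤-refl)

  ΣFin-closed : ∀ {m} {f : Fin m → Fin n → ℚ} → (∀ r → C (f r)) → C (λ i → ΣFin (λ r → f r i))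
  ΣFin-closed {zero} f∈ = zero∈
  ΣFin-closed {suc m} f∈ = +-closed (f∈ Fin.zero) (ΣFin-closed (f∈ ∘ Fin.suc))

coordinate-nonNeg-cone : ∀ {n} (j : Fin n) → IsConvexCone (λ v → 0ℚ ≤ v j)
coordinate-nonNeg-cone j = record
  { zero∈ = ≤-refl
  ; +-closed = +-mono-≤
  ; *-closed = *-nonNeg
  }

module _ {n : ℕ} .{{_ : NonZero n}} (a : ℚ) (w : Fin n → ℚ) where

  Fℚ : Fin n → (Fin n → ℚ) → ℚ
  Fℚ d v = Σℚ n (λ j → a ^ j * (w (d ⊕ j) * v (d ⊕ j)))

  Fℚ-cong : ∀ d {u v : Fin n → ℚ} → (∀ i → u i ≡ v i) → Fℚ d u ≡ Fℚ d v
  Fℚ-cong d u≡v = Σℚ-cong n (λ j _ → cong (λ z → a ^ j * (w (d ⊕ j) * z)) (u≡v (d ⊕ j)))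

  Fℚ-zero : ∀ d → Fℚ d (λ _ → 0ℚ) ≡ 0ℚ
  Fℚ-zero d = Σℚ-zero n (λ j _ → trans (cong (a ^ j *_) (*-zeroʳ (w (d ⊕ j)))) (*-zeroʳ (a ^ j)))

  Fℚ-+ : ∀ d (u v : Fin n → ℚ) → Fℚ d (λ i → u i + v i) ≡ Fℚ d u + Fℚ d v
  Fℚ-+ d u v = trans (Σℚ-cong n (λ j _ → distrib (a ^ j) (w (d ⊕ j)) (u (d ⊕ j)) (v (d ⊕ j)))) (Σℚ-+ n _ _)
    where
    distrib : ∀ x y s t → x * (y * (s + t)) ≡ x * (y * s) + x * (y * t)
    distrib = solve-∀ ℚ-ring

  Fℚ-* : ∀ d c (v : Fin n → ℚ) → Fℚ d (λ i → c * v i) ≡ c * Fℚ d v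
  Fℚ-* d c v = trans (Σℚ-cong n (λ j _ → commute (a ^ j) (w (d ⊕ j)) c (v (d ⊕ j)))) (Σℚ-*ˡ n c _)
    where
    commute : ∀ x y c s → x * (y * (c * s)) ≡ c * (x * (y * s))
    commute = solve-∀ ℚ-ring

  Fℚ-eᵣ : ∀ d r → Fℚ d (λ i → toℚ (eᵣ r i)) ≡ a ^ offset d r * w r
  Fℚ-eᵣ d r = trans (Σℚ-δ n (offset<n d r) vanish) (begin
    a ^ t * (w (d ⊕ t) * toℚ (eᵣ r (d ⊕ t))) ≡⟨ cong (λ z → a ^ t * (w z * toℚ (eᵣ r z))) (⊕-offset d r) ⟩
    a ^ t * (w r * toℚ (eᵣ r r))             ≡⟨ cong (λ z → a ^ t * (w r * toℚ z)) (eᵣ-same r) ⟩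
    a ^ t * (w r * 1ℚ)                       ≡⟨ cong (a ^ t *_) (*-identityʳ (w r)) ⟩
    a ^ t * w r                              ∎)
    where
    open ≡-Reasoning
    t = offset d r
    vanish : ∀ k → k < n → k ≢ t → a ^ k * (w (d ⊕ k) * toℚ (eᵣ r (d ⊕ k))) ≡ 0ℚ
    vanish k k<n k≢t = begin
      a ^ k * (w (d ⊕ k) * toℚ (eᵣ r (d ⊕ k))) ≡⟨ cong (λ z → a ^ k * (w (d ⊕ k) * toℚ z)) (eᵣ-diff r≢d⊕k) ⟩
      a ^ k * (w (d ⊕ k) * 0ℚ)                 ≡⟨ cong (a ^ k *_) (*-zeroʳ (w (d ⊕ k))) ⟩
      a ^ k * 0ℚ                               ≡⟨ *-zeroʳ (a ^ k) ⟩
      0ℚ                                       ∎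
      where
      r≢d⊕k : r ≢ d ⊕ k
      r≢d⊕k r≡d⊕k = k≢t (begin
        k         ≡⟨ m<n⇒m%n≡m k<n ⟨
        k ℕ.% n   ≡⟨ ⊕-injective d (trans (sym r≡d⊕k) (sym (⊕-offset d r))) ⟩
        t ℕ.% n   ≡⟨ m<n⇒m%n≡m (offset<n d r) ⟩
        t         ∎)

  Fℚ-shift : ∀ d v → Fℚ d v ≡ a * Fℚ (d ⊕ 1) v + (1ℚ - a ^ n) * (w d * v d)
  Fℚ-shift d v = begin
    Fℚ d v                                  ≡⟨ add-sub (Fℚ d v) (a ^ n * W) ⟩
    Fℚ d v + a ^ n * W - a ^ n * W          ≡⟨ cong (λ z → Fℚ d v + a ^ n * z - a ^ n * W) (sym (at (⊕-n d))) ⟩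
    Σℚ (suc n) T - a ^ n * W                ≡⟨ cong (_- a ^ n * W) (Σℚ-head n T) ⟩
    T 0 + Σℚ n (T ∘ suc) - a ^ n * W        ≡⟨ cong₂ (λ y z → 1ℚ * y + z - a ^ n * W) (at (⊕-identityʳ d)) tail ⟩
    1ℚ * W + a * Fℚ (d ⊕ 1) v - a ^ n * W   ≡⟨ regroup W (a * Fℚ (d ⊕ 1) v) (a ^ n) ⟩
    a * Fℚ (d ⊕ 1) v + (1ℚ - a ^ n) * W     ∎
    where
    open ≡-Reasoning
    W = w d * v d
    T : ℕ → ℚ
    T j = a ^ j * (w (d ⊕ j) * v (d ⊕ j))
    at : ∀ {j} → d ⊕ j ≡ d → w (d ⊕ j) * v (d ⊕ j) ≡ W
    at = cong (λ z → w z * v z)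
    tail : Σℚ n (T ∘ suc) ≡ a * Fℚ (d ⊕ 1) v
    tail = trans (Σℚ-cong n (λ j _ → trans (cong (λ z → a * a ^ j * (w z * v z)) (sym (⊕-+ d 1 j)))
                                          (*-assoc a (a ^ j) _)))
                 (Σℚ-*ˡ n a _)
    add-sub : ∀ x y → x ≡ x + y - y
    add-sub = solve-∀ ℚ-ring
    regroup : ∀ x y z → 1ℚ * x + y - z * x ≡ y + (1ℚ - z) * x
    regroup = solve-∀ ℚ-ring

  Fℚ-nonPos-cone : ∀ d → IsConvexCone (λ v → Fℚ d v ≤ 0ℚ)
  Fℚ-nonPos-cone d = record
    { zero∈ = ≤-reflexive (Fℚ-zero d)
    ; +-closed = λ {u} {v} Fu≤0 Fv≤0 → subst (_≤ 0ℚ) (sym (Fℚ-+ d u v)) (+-mono-≤ Fu≤0 Fv≤0)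
    ; *-closed = λ {c} {v} 0≤c Fv≤0 → subst (_≤ 0ℚ) (sym (Fℚ-* d c v))
        (subst (c * Fℚ d v ≤_) (*-zeroʳ c) (*-monoˡ-≤-nonNeg c {{ℚ.nonNegative 0≤c}} Fv≤0))
    }

comb-closed : ∀ {n} .{{_ : NonZero n}} p (R : Subset n) g {C} → IsConvexCone C →
              (∀ {r k} → r ∉ R → 1 ℕ.≤ k → k ℕ.≤ g r → C (λ j → toℚ (lam p (g r) r k j))) →
              ∀ c → (∀ r k → 0ℚ ≤ c r k) → C (comb p R g c)
comb-closed p R g {C} cone lam∈ c c≥0 = ΣFin-closed term∈
  where
  open IsConvexCone cone
  term∈ : ∀ r → C (λ j → if lookup R r then 0ℚ
                         else Σℚ (g r) (λ k → c r (suc k) * toℚ (lam p (g r) r (suc k) j)))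
  term∈ r with lookup R r in r∈?
  ... | true = zero∈
  ... | false = Σℚ-closed (g r) (λ k k<g →
          *-closed (c≥0 r (suc k)) (lam∈ (lookup≡false⇒∉ r∈?) (s≤s z≤n) k<g))

module Generators {n : ℕ} .{{_ : NonZero n}} (p : ℕ) (1<p : 1 < p) (R : Subset n) where

  instance
    p≢0 : NonZero p
    p≢0 = ℕ.>-nonZero (ℕ.<-trans ℕ.z<s 1<p)

  P : ℚ
  P = toℚ (+ p)

  Δ : Fin n → ℚ
  Δ r = toℚ (δ R r)

  Δ-∈ : ∀ {r} → r ∈ R → Δ r ≡ - 1ℚ
  Δ-∈ r∈R = cong (λ b → toℚ (if b then ℤ.- (+ 1) else + 1)) ([]=⇒lookup r∈R)

  Δ-∉ : ∀ {r} → r ∉ R → Δ r ≡ 1ℚ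
  Δ-∉ r∉R = cong (λ b → toℚ (if b then ℤ.- (+ 1) else + 1)) (∉⇒lookup≡false r∉R)

  P^-mono : ∀ {s t} → s ℕ.≤ t → P ^ s ≤ P ^ t
  P^-mono {s} {t} s≤t = subst₂ _≤_ (toℚ-^ p s) (toℚ-^ p t) (toℚ-mono-≤ (ℤ.+≤+ (ℕ.^-monoʳ-≤ p s≤t)))

  σ : ℕ → ℕ → ℚ
  σ G k with k ℕ.<? G
  ... | yes _ = P ^ k
  ... | no _ = - P ^ G

  σ-< : ∀ {G k} → k < G → σ G k ≡ P ^ k
  σ-< {G} {k} k<G with k ℕ.<? G
  ... | yes _ = refl
  ... | no k≮G = contradiction k<G k≮G

  σ-≡ : ∀ G → σ G G ≡ - P ^ G
  σ-≡ G with G ℕ.<? G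
  ... | yes G<G = contradiction G<G (ℕ.<-irrefl refl)
  ... | no _ = refl

  toℚ-p^k* : ∀ k z → toℚ (+ (p ℕ.^ k) ℤ.* z) ≡ P ^ k * toℚ z
  toℚ-p^k* k z = trans (toℚ-homo-* (+ (p ℕ.^ k)) z) (cong (_* toℚ z) (toℚ-^ p k))

  toℚ-F : ∀ d (x : Fin n → ℤ) → toℚ (F p R d x) ≡ Fℚ P Δ d (toℚ ∘ x)
  toℚ-F d x = trans (toℚ-Σℤ n _) (Σℚ-cong n (λ j _ →
    trans (toℚ-p^k* j _) (cong (P ^ j *_) (toℚ-homo-* (δ R (d ⊕ j)) (x (d ⊕ j))))))

  lam-split : ∀ {G k} r j → k ℕ.≤ G → toℚ (lam p G r k j) ≡ toℚ (eᵣ r j) + σ G k * toℚ (eᵣ (r ⊝ k) j)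
  lam-split {G} {k} r j k≤G with k ℕ.<? G
  ... | yes _ = trans (toℚ-homo-+ (eᵣ r j) _) (cong (_+_ (toℚ (eᵣ r j))) (toℚ-p^k* k _))
  ... | no k≮G with ℕ.≤-antisym k≤G (ℕ.≮⇒≥ k≮G)
  ...   | refl = trans (toℚ-homo-sub (eᵣ r j) _) (cong (_+_ (toℚ (eᵣ r j)))
                   (trans (cong -_ (toℚ-p^k* k _)) (neg-distribˡ-* (P ^ k) (toℚ (eᵣ (r ⊝ k) j)))))

  P^-nonNeg : ∀ k → 0ℚ ≤ P ^ k
  P^-nonNeg k = ^-nonNeg k (0≤toℚ+ p)

  module _ (g : Fin n → ℕ) (gap : ∀ r → r ∉ R → IsGap R r (g r)) where

    σΔ : ∀ {r k} → r ∉ R → 1 ℕ.≤ k → k ℕ.≤ g r → σ (g r) k * Δ (r ⊝ k) ≡ - P ^ k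
    σΔ {r} {k} r∉R 1≤k k≤g with ℕ.m≤n⇒m<n∨m≡n k≤g
    ... | inj₁ k<g = trans (cong₂ _*_ (σ-< k<g) (Δ-∈ (gap-inside gap r∉R 1≤k k<g))) (times-1 (P ^ k))
      where
      times-1 : ∀ x → x * - 1ℚ ≡ - x
      times-1 = solve-∀ ℚ-ring
    ... | inj₂ refl = trans (cong₂ _*_ (σ-≡ (g r)) (Δ-∉ (gap-outside gap r∉R))) (*-identityʳ _)

    Fℚ-lam : ∀ d {r k} → r ∉ R → 1 ℕ.≤ k → k ℕ.≤ g r →
             Fℚ P Δ d (λ i → toℚ (lam p (g r) r k i)) ≡ P ^ offset d r - P ^ (k ℕ.+ offset d (r ⊝ k))
    Fℚ-lam d {r} {k} r∉R 1≤k k≤g = begin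
      Fℚ P Δ d (λ i → toℚ (lam p (g r) r k i))
        ≡⟨ Fℚ-cong P Δ d (λ i → lam-split r i k≤g) ⟩
      Fℚ P Δ d (λ i → e r i + σ (g r) k * e (r ⊝ k) i)
        ≡⟨ Fℚ-+ P Δ d (e r) (λ i → σ (g r) k * e (r ⊝ k) i) ⟩
      Fℚ P Δ d (e r) + Fℚ P Δ d (λ i → σ (g r) k * e (r ⊝ k) i)
        ≡⟨ cong (_+_ (Fℚ P Δ d (e r))) (Fℚ-* P Δ d (σ (g r) k) (e (r ⊝ k))) ⟩
      Fℚ P Δ d (e r) + σ (g r) k * Fℚ P Δ d (e (r ⊝ k))
        ≡⟨ cong₂ (λ x y → x + σ (g r) k * y) (Fℚ-eᵣ P Δ d r) (Fℚ-eᵣ P Δ d (r ⊝ k)) ⟩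
      P ^ t * Δ r + σ (g r) k * (P ^ t′ * Δ (r ⊝ k))
        ≡⟨ regroup (P ^ t) (Δ r) (σ (g r) k) (P ^ t′) (Δ (r ⊝ k)) ⟩
      P ^ t * Δ r + P ^ t′ * (σ (g r) k * Δ (r ⊝ k))
        ≡⟨ cong₂ (λ x y → P ^ t * x + P ^ t′ * y) (Δ-∉ r∉R) (σΔ r∉R 1≤k k≤g) ⟩
      P ^ t * 1ℚ + P ^ t′ * - P ^ k
        ≡⟨ simplify (P ^ t) (P ^ t′) (P ^ k) ⟩
      P ^ t - P ^ k * P ^ t′
        ≡⟨ cong (_-_ (P ^ t)) (^-homo-* P k t′) ⟨
      P ^ t - P ^ (k ℕ.+ t′)
        ∎
      where
      open ≡-Reasoning
      e : Fin n → Fin n → ℚ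
      e s i = toℚ (eᵣ s i)
      t = offset d r
      t′ = offset d (r ⊝ k)
      regroup : ∀ a b c x y → a * b + c * (x * y) ≡ a * b + x * (c * y)
      regroup = solve-∀ ℚ-ring
      simplify : ∀ a b c → a * 1ℚ + b * - c ≡ a - c * b
      simplify = solve-∀ ℚ-ring

    Fℚ-lam≤0 : ∀ d {r k} → r ∉ R → 1 ℕ.≤ k → k ℕ.≤ g r → Fℚ P Δ d (λ i → toℚ (lam p (g r) r k i)) ≤ 0ℚ
    Fℚ-lam≤0 d {r} {k} r∉R 1≤k k≤g =
      subst (_≤ 0ℚ) (sym (Fℚ-lam d r∉R 1≤k k≤g)) (p≤q⇒p-q≤0 (P^-mono (offset-⊝ d r k)))

    lam-nonNeg : ∀ {r k j} → r ∉ R → k ℕ.≤ g r → j ∈ R → 0ℚ ≤ toℚ (lam p (g r) r k j)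
    lam-nonNeg {r} {k} {j} r∉R k≤g j∈R with ℕ.m≤n⇒m<n∨m≡n k≤g
    ... | inj₁ k<g = subst (0ℚ ≤_) (sym lam≡)
                       (+-mono-≤ (eᵣ-nonNeg r j) (*-nonNeg (P^-nonNeg k) (eᵣ-nonNeg (r ⊝ k) j)))
      where
      lam≡ : toℚ (lam p (g r) r k j) ≡ toℚ (eᵣ r j) + P ^ k * toℚ (eᵣ (r ⊝ k) j)
      lam≡ = trans (lam-split r j k≤g) (cong (λ s → toℚ (eᵣ r j) + s * toℚ (eᵣ (r ⊝ k) j)) (σ-< k<g))
    ... | inj₂ refl = ≤-reflexive (sym (begin
      toℚ (lam p (g r) r (g r) j)
        ≡⟨ lam-split r j k≤g ⟩
      toℚ (eᵣ r j) + σ (g r) (g r) * toℚ (eᵣ (r ⊝ g r) j)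
        ≡⟨ cong₂ (λ x y → toℚ x + σ (g r) (g r) * toℚ y)
                 (eᵣ-diff (≢j r∉R)) (eᵣ-diff (≢j (gap-outside gap r∉R))) ⟩
      0ℚ + σ (g r) (g r) * 0ℚ
        ≡⟨ cong (_+_ 0ℚ) (*-zeroʳ (σ (g r) (g r))) ⟩
      0ℚ
        ∎))
      where
      open ≡-Reasoning
      ≢j : ∀ {s} → s ∉ R → s ≢ j
      ≢j s∉R s≡j = s∉R (subst (_∈ R) (sym s≡j) j∈R)

    Fℚ-comb≤0 : ∀ c → (∀ r k → 0ℚ ≤ c r k) → ∀ d → Fℚ P Δ d (comb p R g c) ≤ 0ℚ
    Fℚ-comb≤0 c c≥0 d = comb-closed p R g (Fℚ-nonPos-cone P Δ d) (Fℚ-lam≤0 d) c c≥0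

    comb-nonNeg : ∀ c → (∀ r k → 0ℚ ≤ c r k) → ∀ j → j ∈ R → 0ℚ ≤ comb p R g c j
    comb-nonNeg c c≥0 j j∈R =
      comb-closed p R g (coordinate-nonNeg-cone j) (λ r∉R _ k≤g → lam-nonNeg r∉R k≤g j∈R) c c≥0

module Coordinates {n : ℕ} .{{_ : NonZero n}} (p : ℕ) (1<p : 1 < p) (R : Subset n)
                   (g : Fin n → ℕ) (gap : ∀ r → r ∉ R → IsGap R r (g r))
                   (c : Fin n → ℕ → ℚ) {j : Fin n} (N : NextOutside R j) where

  open Generators p 1<p R
  open Next gap N

  e : Fin n → Fin n → ℚ
  e r i = toℚ (eᵣ r i)

  term A : Fin n → ℚ
  term r = if lookup R r then 0ℚ else Σℚ (g r) (λ k → c r (suc k) * toℚ (lam p (g r) r (suc k) j))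
  A r = if lookup R r then 0ℚ else Σℚ (g r) (c r ∘ suc)

  B : ℚ
  B = c next (suc t) * σ (g next) (suc t)

  -- Among the λ^(r)_(k+1), only λ^(next)_(t+1) has its second entry at coordinate j.
  single-hit : ∀ {r} → r ∉ R →
               Σℚ (g r) (λ k → c r (suc k) * σ (g r) (suc k) * e (r ⊝ suc k) j) ≡ e r next * B
  single-hit {r} r∉R with r ≟ᶠ next
  ... | yes refl = begin
    Σℚ (g next) (λ k → c next (suc k) * σ (g next) (suc k) * e (next ⊝ suc k) j)
                              ≡⟨ Σℚ-δ (g next) t<g-next vanish ⟩
    B * e (next ⊝ suc t) j    ≡⟨ cong (λ z → B * e z j) next-⊝ ⟩
    B * e j j                 ≡⟨ cong (λ z → B * toℚ z) (eᵣ-same j) ⟩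
    B * 1ℚ                    ≡⟨ *-comm B 1ℚ ⟩
    1ℚ * B                    ∎
    where
    open ≡-Reasoning
    vanish : ∀ k → k < g next → k ≢ t → c next (suc k) * σ (g next) (suc k) * e (next ⊝ suc k) j ≡ 0ℚ
    vanish k k<g k≢t = trans (cong (λ z → c next (suc k) * σ (g next) (suc k) * toℚ z)
                                   (eᵣ-diff (k≢t ∘ ⊝≡j⇒≡t outside k<g)))
                             (*-zeroʳ (c next (suc k) * σ (g next) (suc k)))
  ... | no r≢next = trans (Σℚ-zero (g r) vanish) (sym (*-zeroˡ B))
    where
    vanish : ∀ k → k < g r → c r (suc k) * σ (g r) (suc k) * e (r ⊝ suc k) j ≡ 0ℚ
    vanish k k<g = trans (cong (λ z → c r (suc k) * σ (g r) (suc k) * toℚ z) (eᵣ-diff λ r⊝k≡j →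
                     r≢next (trans (⊝⇒⊕ r⊝k≡j) (cong (λ m → j ⊕ suc m) (⊝≡j⇒≡t r∉R k<g r⊝k≡j)))))
                   (*-zeroʳ (c r (suc k) * σ (g r) (suc k)))

  term-split : ∀ r → (if lookup R r then 0ℚ else Σℚ (g r) (λ k → c r (suc k) * toℚ (lam p (g r) r (suc k) j)))
                     ≡ e r j * (if lookup R r then 0ℚ else Σℚ (g r) (c r ∘ suc)) + e r next * B
  term-split r with lookup R r in r∈?
  ... | true = sym (trans (cong₂ _+_ (*-zeroʳ (e r j)) (trans (cong (λ z → toℚ z * B) (eᵣ-diff r≢next))
                                                           (*-zeroˡ B)))
                         (+-identityˡ 0ℚ))
    where
    r≢next : r ≢ next
    r≢next r≡next = outside (subst (_∈ R) r≡next (lookup⇒[]= r R r∈?))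
  ... | false = begin
    Σℚ (g r) (λ k → c r (suc k) * toℚ (lam p (g r) r (suc k) j))
      ≡⟨ Σℚ-cong (g r) (λ k k<g → trans (cong (c r (suc k) *_) (lam-split r j k<g))
                                        (expand (c r (suc k)) (e r j) (σ (g r) (suc k)) (e (r ⊝ suc k) j))) ⟩
    Σℚ (g r) (λ k → e r j * c r (suc k) + c r (suc k) * σ (g r) (suc k) * e (r ⊝ suc k) j)
      ≡⟨ Σℚ-+ (g r) _ _ ⟩
    Σℚ (g r) (λ k → e r j * c r (suc k)) + Σℚ (g r) (λ k → c r (suc k) * σ (g r) (suc k) * e (r ⊝ suc k) j)
      ≡⟨ cong₂ _+_ (Σℚ-*ˡ (g r) (e r j) (c r ∘ suc)) (single-hit (lookup≡false⇒∉ r∈?)) ⟩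
    e r j * Σℚ (g r) (c r ∘ suc) + e r next * B
      ∎
    where
    open ≡-Reasoning
    expand : ∀ a x s y → a * (x + s * y) ≡ x * a + a * s * y
    expand = solve-∀ ℚ-ring

  A-∈ : ∀ {r} → r ∈ R → A r ≡ 0ℚ
  A-∈ r∈R = cong (λ b → if b then 0ℚ else Σℚ (g _) (c _ ∘ suc)) ([]=⇒lookup r∈R)

  A-∉ : ∀ {r} → r ∉ R → A r ≡ Σℚ (g r) (c r ∘ suc)
  A-∉ r∉R = cong (λ b → if b then 0ℚ else Σℚ (g _) (c _ ∘ suc)) (∉⇒lookup≡false r∉R)

  comb-coordinate : comb p R g c j ≡ A j + B
  comb-coordinate = begin
    comb p R g c j                                       ≡⟨ ΣFin≡sum term ⟩
    sum term                                             ≡⟨ sum-cong-≗ term-split ⟩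
    sum (λ r → e r j * A r + e r next * B)               ≡⟨ ∑-distrib-+ (λ r → e r j * A r) (λ r → e r next * B) ⟩
    sum (λ r → e r j * A r) + sum (λ r → e r next * B)   ≡⟨ cong₂ _+_ (sum-eᵣ j A) (sum-eᵣ next (λ _ → B)) ⟩
    A j + B                                              ∎
    where open ≡-Reasoning

module Forward {n : ℕ} .{{_ : NonZero n}} (p : ℕ) (1<p : 1 < p) (R : Subset n)
               (g : Fin n → ℕ) (gap : ∀ r → r ∉ R → IsGap R r (g r)) {r₀} (r₀∉R : r₀ ∉ R) where

  open Generators p 1<p R

  q : ℚ
  q = p ⁻¹

  qP≡1 : q * P ≡ 1ℚ
  qP≡1 = trans (*-comm q P) (toℚ-*-⁻¹ p)

  1<p^n : 1 < p ℕ.^ n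
  1<p^n = ℕ.<-≤-trans 1<p (subst (ℕ._≤ p ℕ.^ n) (ℕ.*-identityʳ p) (ℕ.^-monoʳ-≤ p (ℕ.>-nonZero⁻¹ n)))

  instance
    p^n∸1≢0 : NonZero (p ℕ.^ n ∸ 1)
    p^n∸1≢0 = ℕ.>-nonZero (ℕ.m<n⇒0<n∸m 1<p^n)

  [P^n-1]⁻¹ : ℚ
  [P^n-1]⁻¹ = (p ℕ.^ n ∸ 1) ⁻¹

  [P^n-1]*⁻¹≡1 : (P ^ n - 1ℚ) * [P^n-1]⁻¹ ≡ 1ℚ
  [P^n-1]*⁻¹≡1 = trans (cong (_* [P^n-1]⁻¹) P^n-1≡) (toℚ-*-⁻¹ (p ℕ.^ n ∸ 1))
    where
    P^n-1≡ : P ^ n - 1ℚ ≡ toℚ (+ (p ℕ.^ n ∸ 1))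
    P^n-1≡ = begin
      P ^ n - 1ℚ                                 ≡⟨ cong (_- 1ℚ) (toℚ-^ p n) ⟨
      toℚ (+ (p ℕ.^ n)) - 1ℚ                     ≡⟨ cong (λ m → toℚ (+ m) - 1ℚ) (ℕ.m∸n+n≡m (ℕ.<⇒≤ 1<p^n)) ⟨
      toℚ (+ (p ℕ.^ n ∸ 1 ℕ.+ 1)) - 1ℚ           ≡⟨ cong (λ z → toℚ z - 1ℚ) (ℤ.pos-+ (p ℕ.^ n ∸ 1) 1) ⟩
      toℚ (+ (p ℕ.^ n ∸ 1) ℤ.+ + 1) - 1ℚ         ≡⟨ cong (_- 1ℚ) (toℚ-homo-+ (+ (p ℕ.^ n ∸ 1)) (+ 1)) ⟩
      toℚ (+ (p ℕ.^ n ∸ 1)) + 1ℚ - 1ℚ            ≡⟨ add-sub (toℚ (+ (p ℕ.^ n ∸ 1))) 1ℚ ⟩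
      toℚ (+ (p ℕ.^ n ∸ 1))                      ∎
      where
      open ≡-Reasoning
      add-sub : ∀ x y → x + y - y ≡ x
      add-sub = solve-∀ ℚ-ring

  module _ (X : Fin n → ℚ) (F≤0 : ∀ d → Fℚ P Δ d X ≤ 0ℚ) (X≥0 : ∀ j → j ∈ R → 0ℚ ≤ X j) where

    y : Fin n → ℚ
    y d = - Fℚ P Δ d X * [P^n-1]⁻¹

    y-nonNeg : ∀ d → 0ℚ ≤ y d
    y-nonNeg d = *-nonNeg (neg-antimono-≤ (F≤0 d)) (⁻¹-nonNeg (p ℕ.^ n ∸ 1))

    y-shift : ∀ d → y d ≡ P * y (d ⊕ 1) + Δ d * X d
    y-shift d = begin
      - Fℚ P Δ d X * u                             ≡⟨ cong (λ z → - z * u) (Fℚ-shift P Δ d X) ⟩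
      - (P * F′ + (1ℚ - P ^ n) * W) * u            ≡⟨ regroup P F′ (P ^ n) W u ⟩
      P * (- F′ * u) + ((P ^ n - 1ℚ) * u) * W      ≡⟨ cong (λ z → P * y (d ⊕ 1) + z * W) [P^n-1]*⁻¹≡1 ⟩
      P * y (d ⊕ 1) + 1ℚ * W                       ≡⟨ cong (_+_ (P * y (d ⊕ 1))) (*-identityˡ W) ⟩
      P * y (d ⊕ 1) + W                            ∎
      where
      open ≡-Reasoning
      u = [P^n-1]⁻¹
      F′ = Fℚ P Δ (d ⊕ 1) X
      W = Δ d * X d
      regroup : ∀ a f b w u → - (a * f + (1ℚ - b) * w) * u ≡ a * (- f * u) + ((b - 1ℚ) * u) * w
      regroup = solve-∀ ℚ-ring

    X-∈ : ∀ {d} → d ∈ R → X d ≡ P * y (d ⊕ 1) - y d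
    X-∈ {d} d∈R = begin
      X d                              ≡⟨ isolate Py′ (X d) ⟩
      Py′ - (Py′ + - 1ℚ * X d)         ≡⟨ cong (λ z → Py′ - (Py′ + z * X d)) (Δ-∈ d∈R) ⟨
      Py′ - (Py′ + Δ d * X d)          ≡⟨ cong (_-_ Py′) (y-shift d) ⟨
      Py′ - y d                        ∎
      where
      open ≡-Reasoning
      Py′ = P * y (d ⊕ 1)
      isolate : ∀ a x → x ≡ a - (a + - 1ℚ * x)
      isolate = solve-∀ ℚ-ring

    -- Rows r ∈ R do not enter comb; they are set to 0 to keep every coefficient nonnegative.
    coeff : Fin n → ℕ → ℚ
    coeff r zero = 0ℚ
    coeff r (suc k) with lookup R r | suc k ℕ.<? g r | suc k ℕ.≟ g r
    ... | true  | _     | _     = 0ℚ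
    ... | false | yes _ | _     = X (r ⊝ suc k) * q ^ suc k
    ... | false | no _  | yes _ = y (r ⊝ k) * q ^ k
    ... | false | no _  | no _  = 0ℚ

    coeff-< : ∀ {r k} → r ∉ R → suc k < g r → coeff r (suc k) ≡ X (r ⊝ suc k) * q ^ suc k
    coeff-< {r} {k} r∉R k<g with lookup R r | ∉⇒lookup≡false r∉R | suc k ℕ.<? g r
    ... | false | _ | yes _ = refl
    ... | false | _ | no k≮g = contradiction k<g k≮g

    coeff-≡ : ∀ {r k} → r ∉ R → suc k ≡ g r → coeff r (suc k) ≡ y (r ⊝ k) * q ^ k
    coeff-≡ {r} {k} r∉R k≡g with lookup R r | ∉⇒lookup≡false r∉R | suc k ℕ.<? g r | suc k ℕ.≟ g r
    ... | false | _ | yes k<g | _ = contradiction k<g (ℕ.<-irrefl k≡g)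
    ... | false | _ | no _ | yes _ = refl
    ... | false | _ | no _ | no k≢g = contradiction k≡g k≢g

    coeff-nonNeg : ∀ r k → 0ℚ ≤ coeff r k
    coeff-nonNeg r zero = ≤-refl
    coeff-nonNeg r (suc k) with lookup R r in r∈? | suc k ℕ.<? g r | suc k ℕ.≟ g r
    ... | true  | _       | _     = ≤-refl
    ... | false | yes k<g | _     = *-nonNeg (X≥0 _ (gap-inside gap (lookup≡false⇒∉ r∈?) (s≤s z≤n) k<g))
                                             (^-nonNeg (suc k) (⁻¹-nonNeg p))
    ... | false | no _    | yes _ = *-nonNeg (y-nonNeg (r ⊝ k)) (^-nonNeg k (⁻¹-nonNeg p))
    ... | false | no _    | no _  = ≤-refl

    Σ-coeff : ∀ {j} → j ∉ R → Σℚ (g j) (coeff j ∘ suc) ≡ y j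
    Σ-coeff {j} j∉R = begin
      Σℚ (g j) (coeff j ∘ suc)                         ≡⟨ cong (λ G → Σℚ G (coeff j ∘ suc)) 1+m≡g ⟨
      Σℚ m (coeff j ∘ suc) + coeff j (suc m)           ≡⟨ cong₂ _+_ (Σℚ-cong m step) (coeff-≡ j∉R 1+m≡g) ⟩
      Σℚ m (λ k → a k - a (suc k)) + a m               ≡⟨ cong (_+ a m) (Σℚ-telescope m a) ⟩
      a 0 - a m + a m                                  ≡⟨ sub-add (a 0) (a m) ⟩
      y (j ⊝ 0) * 1ℚ                                   ≡⟨ *-identityʳ (y (j ⊝ 0)) ⟩
      y (j ⊝ 0)                                        ≡⟨ cong y (⊝-identityʳ j) ⟩
      y j                                              ∎
      where
      open ≡-Reasoning
      m = g j ∸ 1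
      1+m≡g : suc m ≡ g j
      1+m≡g = trans (ℕ.+-comm 1 m) (ℕ.m∸n+n≡m (gap-positive gap j∉R))
      a : ℕ → ℚ
      a k = y (j ⊝ k) * q ^ k
      sub-add : ∀ x z → x - z + z ≡ x
      sub-add = solve-∀ ℚ-ring
      expand : ∀ P q s t Q → (P * s - t) * (q * Q) ≡ (q * P) * (s * Q) - t * (q * Q)
      expand = solve-∀ ℚ-ring
      step : ∀ k → k < m → coeff j (suc k) ≡ a k - a (suc k)
      step k k<m = begin
        coeff j (suc k)
          ≡⟨ coeff-< j∉R 1+k<g ⟩
        X (j ⊝ suc k) * q ^ suc k
          ≡⟨ cong (_* q ^ suc k) (X-∈ (gap-inside gap j∉R (s≤s z≤n) 1+k<g)) ⟩
        (P * y ((j ⊝ suc k) ⊕ 1) - y (j ⊝ suc k)) * q ^ suc k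
          ≡⟨ cong (λ d → (P * y d - y (j ⊝ suc k)) * q ^ suc k) (⊝-suc-⊕ j k) ⟩
        (P * y (j ⊝ k) - y (j ⊝ suc k)) * (q * q ^ k)
          ≡⟨ expand P q (y (j ⊝ k)) (y (j ⊝ suc k)) (q ^ k) ⟩
        (q * P) * a k - a (suc k)
          ≡⟨ cong (λ z → z * a k - a (suc k)) qP≡1 ⟩
        1ℚ * a k - a (suc k)
          ≡⟨ cong (_- a (suc k)) (*-identityˡ (a k)) ⟩
        a k - a (suc k)
          ∎
        where
        1+k<g : suc k < g j
        1+k<g = subst (suc k <_) 1+m≡g (s≤s k<m)

    module _ {j : Fin n} (N : NextOutside R j) where

      open Coordinates p 1<p R g gap coeff N
      open Next gap N

      B-∈ : j ∈ R → B ≡ X j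
      B-∈ j∈R = begin
        coeff next (suc t) * σ (g next) (suc t)        ≡⟨ cong₂ _*_ (coeff-< outside 1+t<g) (σ-< 1+t<g) ⟩
        X (next ⊝ suc t) * q ^ suc t * P ^ suc t       ≡⟨ *-assoc (X (next ⊝ suc t)) (q ^ suc t) (P ^ suc t) ⟩
        X (next ⊝ suc t) * (q ^ suc t * P ^ suc t)     ≡⟨ cong₂ _*_ (cong X next-⊝) (^-inverse {q} {P} (suc t) qP≡1) ⟩
        X j * 1ℚ                                       ≡⟨ *-identityʳ (X j) ⟩
        X j                                            ∎
        where
        open ≡-Reasoning
        1+t<g : suc t < g next
        1+t<g = t<g-next-∈ j∈R

      B-∉ : j ∉ R → B ≡ - (P * y (j ⊕ 1))
      B-∉ j∉R = begin
        coeff next (suc t) * σ (g next) (suc t)         ≡⟨ cong₂ _*_ (coeff-≡ outside (sym g≡)) σ≡ ⟩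
        y (next ⊝ t) * q ^ t * - (P * P ^ t)            ≡⟨ cong (λ d → y d * q ^ t * - (P * P ^ t)) next-⊝-t ⟩
        y (j ⊕ 1) * q ^ t * - (P * P ^ t)               ≡⟨ regroup (y (j ⊕ 1)) (q ^ t) P (P ^ t) ⟩
        - (P * y (j ⊕ 1)) * (q ^ t * P ^ t)             ≡⟨ cong (- (P * y (j ⊕ 1)) *_) (^-inverse {q} {P} t qP≡1) ⟩
        - (P * y (j ⊕ 1)) * 1ℚ                          ≡⟨ *-identityʳ _ ⟩
        - (P * y (j ⊕ 1))                               ∎
        where
        open ≡-Reasoning
        g≡ : g next ≡ suc t
        g≡ = g-next-∉ j∉R
        σ≡ : σ (g next) (suc t) ≡ - (P * P ^ t)
        σ≡ = trans (cong (λ G → σ G (suc t)) g≡) (σ-≡ (suc t))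
        next-⊝-t : next ⊝ t ≡ j ⊕ 1
        next-⊝-t = trans (cong (_⊝ t) (sym (⊕-+ j 1 t))) (⊕-⊝ (j ⊕ 1) t)
        regroup : ∀ a b c d → a * b * - (c * d) ≡ - (c * a) * (b * d)
        regroup = solve-∀ ℚ-ring

      X≡comb : X j ≡ comb p R g coeff j
      X≡comb with j ∈? R
      ... | yes j∈R = sym (begin
        comb p R g coeff j     ≡⟨ comb-coordinate ⟩
        A j + B                ≡⟨ cong₂ _+_ (A-∈ j∈R) (B-∈ j∈R) ⟩
        0ℚ + X j               ≡⟨ +-identityˡ (X j) ⟩
        X j                    ∎)
        where open ≡-Reasoning
      ... | no j∉R = sym (begin
        comb p R g coeff j                  ≡⟨ comb-coordinate ⟩
        A j + B                             ≡⟨ cong₂ _+_ (trans (A-∉ j∉R) (Σ-coeff j∉R)) (B-∉ j∉R) ⟩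
        y j - Py′                           ≡⟨ cong (_- Py′) (y-shift j) ⟩
        Py′ + Δ j * X j - Py′               ≡⟨ cong (λ z → Py′ + z * X j - Py′) (Δ-∉ j∉R) ⟩
        Py′ + 1ℚ * X j - Py′                ≡⟨ cancel Py′ (X j) ⟩
        X j                                 ∎)
        where
        open ≡-Reasoning
        Py′ = P * y (j ⊕ 1)
        cancel : ∀ a x → a + 1ℚ * x - a ≡ x
        cancel = solve-∀ ℚ-ring

    polyhedron⊆cone : Σ (Fin n → ℕ → ℚ) λ c → (∀ r k → 0ℚ ≤ c r k) × (∀ j → X j ≡ comb p R g c j)
    polyhedron⊆cone = coeff , coeff-nonNeg , λ j → X≡comb (nextOutside R r₀∉R j)

proposition5p11p1 : (n : ℕ) .{{_ : NonZero n}} (p : ℕ) → Prime p →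
    (R : Subset n) → ∃ (λ r → r ∉ R) →
    (g : Fin n → ℕ) → (∀ r → r ∉ R → IsGap R r (g r)) →
    (x : Fin n → ℤ) → (InP p R x ⇔ InCone p R g x)
proposition5p11p1 n p p-prime R (r₀ , r₀∉R) g gap x = mk⇔ forward backward
  where
  1<p : 1 < p
  1<p = nonTrivial⇒n>1 p {{prime⇒nonTrivial p-prime}}
  open Generators p 1<p R

  forward : InP p R x → InCone p R g x
  forward (F≤0 , x≥0) = Forward.polyhedron⊆cone p 1<p R g gap r₀∉R (toℚ ∘ x)
    (λ d → subst (_≤ 0ℚ) (toℚ-F d x) (toℚ-mono-≤ (F≤0 d)))
    (λ j j∈R → toℚ-mono-≤ (x≥0 j j∈R))

  backward : InCone p R g x → InP p R x
  backward (c , c≥0 , x≡comb) = F≤0 , x≥0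
    where
    F≤0 : ∀ d → F p R d x ℤ.≤ + 0
    F≤0 d = toℚ-cancel-≤ (subst (_≤ 0ℚ) (sym (trans (toℚ-F d x) (Fℚ-cong P Δ d x≡comb)))
                                         (Fℚ-comb≤0 g gap c c≥0 d))
    x≥0 : ∀ j → j ∈ R → + 0 ℤ.≤ x j
    x≥0 j j∈R = toℚ-cancel-≤ (subst (0ℚ ≤_) (sym (x≡comb j)) (comb-nonNeg g gap c c≥0 j j∈R))
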